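{- For every partition $\lambda\vdash n$, the fake degree polynomial satisfies \[ f_\lambda(q)=\sum_{T\in\mathrm{SYT}(\lambda)}q^{\mathrm{dep}(T)}. \]
   Context: $\mathrm{SYT}(\lambda)$ is the set of standard Young tableaux of shape $\lambda$. For $T\in\mathrm{SYT}(\lambda)$, $\mathrm{Des}\,T=\{i\in\{1,\dots,n-1\}: i+1 \text{ lies in a row strictly below the row of } i\}$, $\mathrm{maj}(T)=\sum_{i\in\mathrm{Des}\,T}i$; if $\mathrm{Des}\,T=\{a_1<\dots<a_k\}$, $\mathrm{des}\,T=(a_1,a_2-a_1,\dots,a_k-a_{k-1},n-a_k)$, and $\mathrm{dep}(T)=\sum_i(i-1)\alpha_i$ where $\alpha=\mathrm{des}\,T$. The fake degree polynomial is $f_\lambda(q)=\sum_{T\in\mathrm{SYT}(\lambda)}q^{\mathrm{maj}(T)}$. -}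

module Defs where

open import Data.Bool using (Bool; true; false; _∧_; T; if_then_else_)
open import Data.Nat using (ℕ; zero; suc; _+_; _*_; _∸_; _≤_; _<_; _≥_; _≡ᵇ_; _<ᵇ_)
open import Data.List using (List; []; _∷_; map; length; concat; upTo; filter)
open import Data.Nat.ListAction using (sum)
open import Data.List.Relation.Unary.All using (All)
open import Data.List.Relation.Unary.Linked using (Linked)
open import Data.Product using (Σ; _×_; _,_; proj₁)
open import Relation.Binary.PropositionalEquality using (_≡_)
open import Relation.Nullary.Decidable using (does)
open import Data.Nat using (_≟_)

IsPartition : List ℕ → Set
IsPartition λ′ = Linked _≥_ λ′ × All (0 <_) λ′

size : List ℕ → ℕ
size = sum

-- Tableaux (English convention): a filling is the list of its rows,
-- row 0 on top; row r is the list of its entries from left to right.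

Filling : Set
Filling = List (List ℕ)

allB : {A : Set} → (A → Bool) → List A → Bool
allB p []       = true
allB p (x ∷ xs) = p x ∧ allB p xs

occ : ℕ → List ℕ → ℕ
occ i []       = 0
occ i (x ∷ xs) = if x ≡ᵇ i then suc (occ i xs) else occ i xs

strictInc : List ℕ → Bool
strictInc []           = true
strictInc (x ∷ [])     = true
strictInc (x ∷ y ∷ xs) = (x <ᵇ y) ∧ strictInc (y ∷ xs)

colInc : List ℕ → List ℕ → Bool
colInc u       []      = true
colInc []      (y ∷ l) = false
colInc (x ∷ u) (y ∷ l) = (x <ᵇ y) ∧ colInc u l

colsInc : Filling → Bool
colsInc []            = true
colsInc (r ∷ [])      = true
colsInc (r ∷ s ∷ rs)  = colInc r s ∧ colsInc (s ∷ rs)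

hasShape : List ℕ → Filling → Bool
hasShape []       []       = true
hasShape []       (_ ∷ _)  = false
hasShape (_ ∷ _)  []       = false
hasShape (m ∷ λ′) (r ∷ rs) = (length r ≡ᵇ m) ∧ hasShape λ′ rs

oneTo : ℕ → List ℕ
oneTo n = map suc (upTo n)

-- T is a standard Young tableau of shape λ ⊢ n: shape λ, each of 1..n occurs
-- exactly once (so, as there are n cells, the entries are exactly 1..n),
-- rows strictly increase left to right, columns strictly increase downwards.
isSYT : List ℕ → Filling → Bool
isSYT λ′ t =
  hasShape λ′ t
  ∧ allB (λ i → occ i (concat t) ≡ᵇ 1) (oneTo (size λ′))
  ∧ allB strictInc t
  ∧ colsInc t

SYT : List ℕ → Set
SYT λ′ = Σ Filling (λ t → T (isSYT λ′ t))

-- index of the row containing i (0 = top row)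
rowOf : ℕ → Filling → ℕ
rowOf i []       = 0
rowOf i (r ∷ rs) = if does (Data.List.Membership.DecPropositional._∈?_ _≟_ i r)
                     then 0 else suc (rowOf i rs)
  where import Data.List.Membership.DecPropositional

Des : (λ′ : List ℕ) → SYT λ′ → List ℕ
Des λ′ (t , _) =
  filter (λ i → rowOf i t <? rowOf (suc i) t) (oneTo (size λ′ ∸ 1))
  where open Data.Nat using (_<?_)

maj : (λ′ : List ℕ) → SYT λ′ → ℕ
maj λ′ T′ = sum (Des λ′ T′)

-- des T = (a₁, a₂ - a₁, …, a_k - a_{k-1}, n - a_k) for Des T = {a₁<…<a_k}
compositionFrom : ℕ → List ℕ → ℕ → List ℕ
compositionFrom prev []       n = (n ∸ prev) ∷ []
compositionFrom prev (a ∷ as) n = (a ∸ prev) ∷ compositionFrom a as n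

des : (λ′ : List ℕ) → SYT λ′ → List ℕ
des λ′ T′ = compositionFrom 0 (Des λ′ T′) (size λ′)

-- Σ_i (i-1) α_i, with α = (α₁, α₂, …)
weighted : ℕ → List ℕ → ℕ
weighted k []       = 0
weighted k (a ∷ as) = k * a + weighted (suc k) as

dep : (λ′ : List ℕ) → SYT λ′ → ℕ
dep λ′ T′ = weighted 0 (des λ′ T′)

{-# OPTIONS --safe #-}

-- Write a standard tableau of shape λ ⊢ n as its row word w = w₁ … wₙ, where wᵢ is the row
-- containing i: these are exactly the lattice (Yamanouchi) words of content λ, and
-- i ∈ Des T iff wᵢ < wᵢ₊₁. As dep T = Σ_{a ∈ Des T} (n - a), it suffices to find an
-- involution of SYT(λ) carrying Des T to n - Des T, and Schützenberger's evacuation does.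
-- On row words, promotion Δ deletes the first letter and passes a carried letter through
-- the word by local switches; evacuation is ev(w) = ev(Δ w) followed by the exit letter of
-- Δ w. A switch is an involution that preserves the comparison of consecutive letters of a
-- lattice word, so Δ shifts the ascent pattern by one place, the last two exit letters
-- compare like w₁ and w₂, and the ascent pattern of ev(w) is that of w reversed; the
-- involutivity of switches makes ev an involution.

module Submission where

open import Defs
open import Data.Bool using (Bool; true; false; _∧_; _∨_; not; T; if_then_else_)
open import Data.Bool.Properties using (T-irrelevant; T-∧; T-≡; ∧-assoc; ∧-comm; ∧-identityʳ; ∧-zeroʳ)
open import Data.Empty using (⊥-elim)
open import Data.Fin as Fin using (Fin; toℕ)
open import Data.List
  using ( List; []; _∷_; _++_; _∷ʳ_; length; foldl; reverse; map; iterate; filter; concat; applyUpTo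
        ; lookup; tabulate)
open import Data.List.Membership.Propositional.Properties using (∈-lookup)
open import Data.List.Properties
  using ( foldl-∷ʳ; unfold-reverse; length-reverse; length-++; length-map; length-iterate; map-id; map-∘
        ; map-cong; map-cong-local; map-++; ++-identityʳ; map-applyUpTo; tabulate-cong; tabulate-lookup
        ; filter-complete; filter-accept; filter-reject)
open import Data.List.Relation.Unary.All as All using (All; []; _∷_)
open import Data.List.Relation.Unary.All.Properties using (∷ʳ⁻; all-filter; map⁺; concat⁻)
open import Data.List.Reverse using (Reverse; []; _∶_∶ʳ_; reverseView)
open import Data.Nat
  using (ℕ; zero; suc; _+_; _*_; _∸_; _≤_; _<_; _≡ᵇ_; _<ᵇ_; z≤n; s≤s; z<s; _≤?_; _<?_)
open import Data.Nat.ListAction using (sum)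
open import Data.Nat.Properties
open import Data.Nat.Solver using (module +-*-Solver)
open import Data.Product using (Σ; _×_; _,_; proj₁; proj₂; map₁)
open import Function.Base using (_∘_; id)
open import Function.Bundles using (Equivalence; _↔_; mk↔ₛ′)
open import Relation.Binary.PropositionalEquality
open import Relation.Nullary using (¬_; yes; no; does)
open import Relation.Nullary.Decidable using (_×-dec_)
open import Relation.Unary using (Decidable)

open +-*-Solver using (solve; _:*_; _:+_; con; _:=_)
open import Data.List.Membership.DecPropositional _≟_ using (_∈?_)
open import Algebra.Properties.CommutativeSemigroup +-commutativeSemigroup using (interchange)

T-∧⁻ : ∀ {a b} → T (a ∧ b) → T a × T b
T-∧⁻ = Equivalence.to T-∧

T-∧⁺ : ∀ {a b} → T a → T b → T (a ∧ b)
T-∧⁺ p q = Equivalence.from T-∧ (p , q)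

≡ᵇ-sym : ∀ a b → (a ≡ᵇ b) ≡ (b ≡ᵇ a)
≡ᵇ-sym zero    zero    = refl
≡ᵇ-sym zero    (suc b) = refl
≡ᵇ-sym (suc a) zero    = refl
≡ᵇ-sym (suc a) (suc b) = ≡ᵇ-sym a b

≡ᵇ-refl : ∀ a → (a ≡ᵇ a) ≡ true
≡ᵇ-refl a = Equivalence.to T-≡ (≡⇒≡ᵇ a a refl)

≡ᵇ-≢ : ∀ {a b} → a ≢ b → (a ≡ᵇ b) ≡ false
≡ᵇ-≢ {a} {b} a≢b with a ≡ᵇ b in eq
... | true  = ⊥-elim (a≢b (≡ᵇ⇒≡ a b (subst T (sym eq) _)))
... | false = refl

≤⇒≮ᵇ : ∀ {m n} → n ≤ m → (m <ᵇ n) ≡ false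
≤⇒≮ᵇ {m} {n} n≤m with m <ᵇ n in eq
... | true  = ⊥-elim (≤⇒≯ n≤m (<ᵇ⇒< m n (subst T (sym eq) _)))
... | false = refl

<ᵇ-suc-≢ : ∀ b a → b ≢ a → (b <ᵇ suc a) ≡ (b <ᵇ a)
<ᵇ-suc-≢ zero    zero    b≢a = ⊥-elim (b≢a refl)
<ᵇ-suc-≢ zero    (suc a) _   = refl
<ᵇ-suc-≢ (suc b) zero    _   = refl
<ᵇ-suc-≢ (suc b) (suc a) b≢a = <ᵇ-suc-≢ b a (b≢a ∘ cong suc)

suc-<ᵇ-≢ : ∀ a b → b ≢ suc a → (suc a <ᵇ b) ≡ (a <ᵇ b)
suc-<ᵇ-≢ a       zero          _   = refl
suc-<ᵇ-≢ zero    (suc zero)    b≢a = ⊥-elim (b≢a refl)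
suc-<ᵇ-≢ zero    (suc (suc b)) _   = refl
suc-<ᵇ-≢ (suc a) (suc b)       b≢a = suc-<ᵇ-≢ a b (b≢a ∘ cong suc)

∸-split : ∀ {p k n} → p ≤ k → k ≤ n → n ∸ p ≡ (k ∸ p) + (n ∸ k)
∸-split {p} {k} {n} p≤k k≤n = begin
  n ∸ p             ≡⟨ cong (_∸ p) (m∸n+n≡m k≤n) ⟨
  (n ∸ k + k) ∸ p   ≡⟨ +-∸-assoc (n ∸ k) p≤k ⟩
  (n ∸ k) + (k ∸ p) ≡⟨ +-comm (n ∸ k) (k ∸ p) ⟩
  (k ∸ p) + (n ∸ k) ∎
  where open ≡-Reasoning

length-∷ʳ : ∀ {A : Set} (w : List A) y → length (w ∷ʳ y) ≡ suc (length w)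
length-∷ʳ w y = trans (length-++ w) (+-comm (length w) 1)

∷ʳ≢[] : ∀ {A : Set} (w : List A) y → w ∷ʳ y ≢ []
∷ʳ≢[] []      y ()
∷ʳ≢[] (x ∷ w) y ()

δ : ℕ → ℕ → ℕ
δ x r = if x ≡ᵇ r then 1 else 0

δ-self : ∀ x → δ x x ≡ 1
δ-self zero    = refl
δ-self (suc x) = δ-self x

δ-≢ : ∀ {x r} → x ≢ r → δ x r ≡ 0
δ-≢ x≢r rewrite ≡ᵇ-≢ x≢r = refl

occ-∷ : ∀ r x w → occ r (x ∷ w) ≡ δ x r + occ r w
occ-∷ r x w with x ≡ᵇ r
... | true  = refl
... | false = refl

occ-++ : ∀ r u v → occ r (u ++ v) ≡ occ r u + occ r v
occ-++ r []      v = refl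
occ-++ r (x ∷ u) v rewrite occ-∷ r x (u ++ v) | occ-∷ r x u | occ-++ r u v =
  sym (+-assoc (δ x r) (occ r u) (occ r v))

occ-∷ʳ : ∀ r w y → occ r (w ∷ʳ y) ≡ occ r w + δ y r
occ-∷ʳ r w y = occ-++ r w (y ∷ [])

occ-All-≢ : ∀ i L → All (_≢ i) L → occ i L ≡ 0
occ-All-≢ i []      []           = refl
occ-All-≢ i (x ∷ L) (x≢i ∷ x≢is) rewrite occ-∷ i x L | δ-≢ x≢i = occ-All-≢ i L x≢is

-- Contents and lattice words

Content : Set
Content = ℕ → ℕ

∅ : Content
∅ _ = 0

infixl 6 _⊕_ _⊕⋆_

_⊕_ : Content → ℕ → Content
(c ⊕ x) r = c r + δ x r

_⊕⋆_ : Content → List ℕ → Content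
_⊕⋆_ = foldl _⊕_

content : List ℕ → Content
content w = ∅ ⊕⋆ w

⊕⋆-occ : ∀ c w r → (c ⊕⋆ w) r ≡ c r + occ r w
⊕⋆-occ c []      r = sym (+-identityʳ (c r))
⊕⋆-occ c (x ∷ w) r rewrite ⊕⋆-occ (c ⊕ x) w r | occ-∷ r x w = +-assoc (c r) (δ x r) (occ r w)

content-occ : ∀ w r → content w r ≡ occ r w
content-occ = ⊕⋆-occ ∅

content-∷ʳ : ∀ w y → content (w ∷ʳ y) ≗ content w ⊕ y
content-∷ʳ w y r = cong (λ c → c r) (foldl-∷ʳ _⊕_ ∅ y w)

⊕-cong : ∀ {c c′} → c ≗ c′ → ∀ x → c ⊕ x ≗ c′ ⊕ x
⊕-cong c≗c′ x r = cong (_+ δ x r) (c≗c′ r)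

⊕-comm : ∀ c a b → c ⊕ a ⊕ b ≗ c ⊕ b ⊕ a
⊕-comm c a b r = trans (+-assoc (c r) (δ a r) (δ b r))
  (trans (cong (c r +_) (+-comm (δ a r) (δ b r))) (sym (+-assoc (c r) (δ b r) (δ a r))))

-- a cell may be added in row x of the shape with row lengths c
addable : Content → ℕ → Bool
addable c zero    = true
addable c (suc x) = c (suc x) <ᵇ c x

Decreasing : Content → Set
Decreasing c = ∀ r → c (suc r) ≤ c r

latticeFrom : Content → List ℕ → Bool
latticeFrom c []      = true
latticeFrom c (x ∷ w) = addable c x ∧ latticeFrom (c ⊕ x) w

Lattice : List ℕ → Set
Lattice w = T (latticeFrom ∅ w)

latticeFrom-∷⁻ : ∀ {c} x w → T (latticeFrom c (x ∷ w)) → T (addable c x) × T (latticeFrom (c ⊕ x) w)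
latticeFrom-∷⁻ {c} x w = T-∧⁻ {addable c x}

latticeFrom-∷ʳ : ∀ c w y → latticeFrom c (w ∷ʳ y) ≡ latticeFrom c w ∧ addable (c ⊕⋆ w) y
latticeFrom-∷ʳ c []      y = ∧-identityʳ (addable c y)
latticeFrom-∷ʳ c (x ∷ w) y rewrite latticeFrom-∷ʳ (c ⊕ x) w y =
  sym (∧-assoc (addable c x) (latticeFrom (c ⊕ x) w) _)

lattice-∷ʳ⁻ : ∀ w y → Lattice (w ∷ʳ y) → Lattice w × T (addable (content w) y)
lattice-∷ʳ⁻ w y lat = T-∧⁻ (subst T (latticeFrom-∷ʳ ∅ w y) lat)

lattice-∷ʳ⁺ : ∀ w y → Lattice w → T (addable (content w) y) → Lattice (w ∷ʳ y)
lattice-∷ʳ⁺ w y lat add = subst T (sym (latticeFrom-∷ʳ ∅ w y)) (T-∧⁺ lat add)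

addable-cong : ∀ {c c′} → c ≗ c′ → ∀ x → addable c x ≡ addable c′ x
addable-cong c≗c′ zero    = refl
addable-cong c≗c′ (suc x) = cong₂ _<ᵇ_ (c≗c′ (suc x)) (c≗c′ x)

latticeFrom-cong : ∀ {c c′} → c ≗ c′ → ∀ w → latticeFrom c w ≡ latticeFrom c′ w
latticeFrom-cong c≗c′ []      = refl
latticeFrom-cong c≗c′ (x ∷ w) =
  cong₂ _∧_ (addable-cong c≗c′ x) (latticeFrom-cong (⊕-cong c≗c′ x) w)

Decreasing-cong : ∀ {c c′} → c ≗ c′ → Decreasing c → Decreasing c′
Decreasing-cong c≗c′ dec r = subst₂ _≤_ (c≗c′ (suc r)) (c≗c′ r) (dec r)

Decreasing-∅ : Decreasing ∅
Decreasing-∅ _ = z≤n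

Decreasing-⊕ : ∀ {c} x → Decreasing c → T (addable c x) → Decreasing (c ⊕ x)
Decreasing-⊕ {c} x dec add r with x ≟ r | x ≟ suc r
... | yes refl | yes x≡1+x = ⊥-elim (1+n≢n (sym x≡1+x))
... | yes refl | no  x≢1+x rewrite δ-≢ x≢1+x | δ-self x | +-identityʳ (c (suc x)) =
  m≤n⇒m≤n+o 1 (dec x)
... | no  x≢r  | yes refl  rewrite δ-≢ x≢r | δ-self x | +-identityʳ (c r) | +-comm (c x) 1 =
  <ᵇ⇒< (c x) (c r) add
... | no  x≢r  | no  x≢1+r rewrite δ-≢ x≢r | δ-≢ x≢1+r = +-monoˡ-≤ 0 (dec r)

Decreasing-⊕⇒addable : ∀ {c} x → Decreasing c → Decreasing (c ⊕ x) → T (addable c x)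
Decreasing-⊕⇒addable zero        _ _    = _
Decreasing-⊕⇒addable {c} (suc x) _ dec′ = <⇒<ᵇ (subst₂ _≤_ lhs rhs (dec′ x))
  where
  lhs : c (suc x) + δ (suc x) (suc x) ≡ suc (c (suc x))
  lhs = trans (cong (c (suc x) +_) (δ-self x)) (+-comm (c (suc x)) 1)
  rhs : c x + δ (suc x) x ≡ c x
  rhs = trans (cong (c x +_) (δ-≢ (1+n≢n {x}))) (+-identityʳ (c x))

Decreasing-⊕⋆ : ∀ {c} w → Decreasing c → T (latticeFrom c w) → Decreasing (c ⊕⋆ w)
Decreasing-⊕⋆ []      dec _   = dec
Decreasing-⊕⋆ (x ∷ w) dec lat with add-x , lat′ ← latticeFrom-∷⁻ x w lat =
  Decreasing-⊕⋆ w (Decreasing-⊕ x dec add-x) lat′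

Lattice⇒Decreasing : ∀ w → Lattice w → Decreasing (content w)
Lattice⇒Decreasing w = Decreasing-⊕⋆ w Decreasing-∅

addable-⊕-≢ : ∀ {c} a b → T (addable c a) → a ≢ b → T (addable (c ⊕ b) a)
addable-⊕-≢ zero        b _   _   = _
addable-⊕-≢ {c} (suc a) b add a≢b rewrite δ-≢ (a≢b ∘ sym) | +-identityʳ (c (suc a)) =
  <⇒<ᵇ (≤-trans (<ᵇ⇒< _ _ add) (m≤m+n (c a) (δ b a)))

addable-⊕⇒≡suc : ∀ {c} x y → Decreasing c → addable c y ≡ false → T (addable (c ⊕ x) y) →
                 y ≡ suc x
addable-⊕⇒≡suc x zero dec () _
addable-⊕⇒≡suc {c} x (suc y) dec blocked add with x ≟ y
... | yes refl = refl
... | no  x≢y  = ⊥-elim (subst T blocked (<⇒<ᵇ c[1+y]<c[y]))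
  where
  c[1+y]<c[y] : c (suc y) < c y
  c[1+y]<c[y] = ≤-<-trans (m≤m+n (c (suc y)) (δ x (suc y)))
    (subst (c (suc y) + δ x (suc y) <_) (trans (cong (c y +_) (δ-≢ x≢y)) (+-identityʳ (c y)))
      (<ᵇ⇒< _ _ add))

addable-⊕-suc : ∀ {c} a → Decreasing c → T (addable (c ⊕ a) (suc a))
addable-⊕-suc {c} a dec
  rewrite δ-≢ (≢-sym (1+n≢n {a})) | δ-self a | +-identityʳ (c (suc a)) | +-comm (c a) 1 =
  <⇒<ᵇ (s≤s (dec a))

addable-⊕-⊕-suc : ∀ c a → addable (c ⊕ a ⊕ suc a) (suc a) ≡ addable c (suc a)
addable-⊕-⊕-suc c a
  rewrite δ-≢ (≢-sym (1+n≢n {a})) | δ-≢ (1+n≢n {a}) | δ-self a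
        | +-identityʳ (c (suc a)) | +-identityʳ (c a + 1) | +-comm (c (suc a)) 1 | +-comm (c a) 1 = refl

-- Promotion and evacuation of words

swappable : Content → ℕ → ℕ → Bool
swappable c a b = not (a ≡ᵇ b) ∧ (addable c a ∧ addable c b)

switch : Content → ℕ → ℕ → ℕ × ℕ
switch c a b = if swappable c a b then (b , a) else (a , b)

slide : Content → ℕ → List ℕ → List ℕ × ℕ
slide c a []      = [] , a
slide c a (b ∷ w) = let (out , carry) = switch c a b in map₁ (out ∷_) (slide (c ⊕ out) carry w)

-- On the row word of a standard tableau T, Δ returns the row word of the tableau obtained
-- by deleting 1, sliding the hole out by jeu de taquin and lowering all entries by 1,
-- together with the row of the vacated cell.
Δ : List ℕ → List ℕ × ℕ
Δ []      = [] , 0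
Δ (x ∷ w) = slide ∅ x w

promote : List ℕ → List ℕ
promote w = proj₁ (Δ w)

vacated : List ℕ → ℕ
vacated w = proj₂ (Δ w)

-- the fuel n is the length of w
evacuation : ℕ → List ℕ → List ℕ
evacuation zero    w = []
evacuation (suc n) w = evacuation n (promote w) ∷ʳ vacated w

swappable-sym : ∀ c a b → swappable c a b ≡ swappable c b a
swappable-sym c a b = cong₂ (λ p q → not p ∧ q) (≡ᵇ-sym a b) (∧-comm (addable c a) (addable c b))

switch-involutive : ∀ c a b → let (a′ , b′) = switch c a b in switch c a′ b′ ≡ (a , b)
switch-involutive c a b with swappable c a b in eq
... | true  rewrite swappable-sym c b a | eq = refl
... | false rewrite eq = refl

switch-cong : ∀ {c c′} → c ≗ c′ → ∀ a b → switch c a b ≡ switch c′ a b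
switch-cong c≗c′ a b = cong (if_then (b , a) else (a , b))
  (cong₂ (λ p q → not (a ≡ᵇ b) ∧ (p ∧ q)) (addable-cong c≗c′ a) (addable-cong c≗c′ b))

switch-δ : ∀ c a b r → let (a′ , b′) = switch c a b in δ a′ r + δ b′ r ≡ δ a r + δ b r
switch-δ c a b r with swappable c a b
... | true  = +-comm (δ b r) (δ a r)
... | false = refl

switch-⊕ : ∀ c a b → let (a′ , b′) = switch c a b in c ⊕ a ⊕ b ≗ c ⊕ a′ ⊕ b′
switch-⊕ c a b r = begin
  c r + δ a r + δ b r     ≡⟨ +-assoc (c r) (δ a r) (δ b r) ⟩
  c r + (δ a r + δ b r)   ≡⟨ cong (c r +_) (switch-δ c a b r) ⟨
  c r + (δ a′ r + δ b′ r) ≡⟨ +-assoc (c r) (δ a′ r) (δ b′ r) ⟨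
  c r + δ a′ r + δ b′ r   ∎
  where
  open ≡-Reasoning
  a′ = proj₁ (switch c a b)
  b′ = proj₂ (switch c a b)

switch-∅ : ∀ a b → switch ∅ a b ≡ (a , b)
switch-∅ zero    zero    = refl
switch-∅ zero    (suc b) = refl
switch-∅ (suc a) b with suc a ≡ᵇ b
... | true  = refl
... | false = refl

slideStep : Content → List ℕ × ℕ → ℕ → List ℕ × ℕ
slideStep c (w , a) y = map₁ (w ∷ʳ_) (switch (c ⊕⋆ w) a y)

slide-∷ʳ : ∀ c a w y → slide c a (w ∷ʳ y) ≡ slideStep c (slide c a w) y
slide-∷ʳ c a []      y = refl
slide-∷ʳ c a (b ∷ w) y = cong (map₁ (proj₁ (switch c a b) ∷_))
  (slide-∷ʳ (c ⊕ proj₁ (switch c a b)) (proj₂ (switch c a b)) w y)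

Δ-∷ʳ : ∀ v y → v ≢ [] → Δ (v ∷ʳ y) ≡ slideStep ∅ (Δ v) y
Δ-∷ʳ []      y v≢[] = ⊥-elim (v≢[] refl)
Δ-∷ʳ (x ∷ v) y _    = slide-∷ʳ ∅ x v y

length-slide : ∀ c a w → length (proj₁ (slide c a w)) ≡ length w
length-slide c a []      = refl
length-slide c a (b ∷ w) = cong suc (length-slide _ _ w)

length-promote : ∀ x w → length (promote (x ∷ w)) ≡ length w
length-promote = length-slide ∅

length-evacuation : ∀ n w → length (evacuation n w) ≡ n
length-evacuation zero    w = refl
length-evacuation (suc n) w =
  trans (length-∷ʳ (evacuation n (promote w)) _) (cong suc (length-evacuation n (promote w)))

slide-occ : ∀ c a w r → let (w′ , a′) = slide c a w in occ r w′ + δ a′ r ≡ δ a r + occ r w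
slide-occ c a []      r = sym (+-identityʳ (δ a r))
slide-occ c a (b ∷ w) r = begin
  occ r (out ∷ w′) + δ a′ r       ≡⟨ cong (_+ δ a′ r) (occ-∷ r out w′) ⟩
  δ out r + occ r w′ + δ a′ r     ≡⟨ +-assoc (δ out r) (occ r w′) (δ a′ r) ⟩
  δ out r + (occ r w′ + δ a′ r)   ≡⟨ cong (δ out r +_) (slide-occ (c ⊕ out) carry w r) ⟩
  δ out r + (δ carry r + occ r w) ≡⟨ +-assoc (δ out r) (δ carry r) (occ r w) ⟨
  δ out r + δ carry r + occ r w   ≡⟨ cong (_+ occ r w) (switch-δ c a b r) ⟩
  δ a r + δ b r + occ r w         ≡⟨ +-assoc (δ a r) (δ b r) (occ r w) ⟩
  δ a r + (δ b r + occ r w)       ≡⟨ cong (δ a r +_) (occ-∷ r b w) ⟨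
  δ a r + occ r (b ∷ w)           ∎
  where
  open ≡-Reasoning
  out = proj₁ (switch c a b)
  carry = proj₂ (switch c a b)
  w′ = proj₁ (slide (c ⊕ out) carry w)
  a′ = proj₂ (slide (c ⊕ out) carry w)

Δ-occ : ∀ x w r → occ r (promote (x ∷ w)) + δ (vacated (x ∷ w)) r ≡ occ r (x ∷ w)
Δ-occ x w r = trans (slide-occ ∅ x w r) (sym (occ-∷ r x w))

content-Δ : ∀ v → v ≢ [] → content (promote v) ⊕ vacated v ≗ content v
content-Δ []      v≢[] = ⊥-elim (v≢[] refl)
content-Δ (x ∷ w) _    r = begin
  content (promote (x ∷ w)) r + δ (vacated (x ∷ w)) r
    ≡⟨ cong (_+ δ (vacated (x ∷ w)) r) (content-occ (promote (x ∷ w)) r) ⟩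
  occ r (promote (x ∷ w)) + δ (vacated (x ∷ w)) r
    ≡⟨ Δ-occ x w r ⟩
  occ r (x ∷ w)
    ≡⟨ content-occ (x ∷ w) r ⟨
  content (x ∷ w) r ∎
  where open ≡-Reasoning

evacuation-occ : ∀ n w → length w ≡ n → ∀ r → occ r (evacuation n w) ≡ occ r w
evacuation-occ zero    []      _   r = refl
evacuation-occ (suc n) (x ∷ w) len r = begin
  occ r (evacuation n (promote (x ∷ w)) ∷ʳ vacated (x ∷ w))
    ≡⟨ occ-∷ʳ r (evacuation n (promote (x ∷ w))) (vacated (x ∷ w)) ⟩
  occ r (evacuation n (promote (x ∷ w))) + δ (vacated (x ∷ w)) r
    ≡⟨ cong (_+ δ (vacated (x ∷ w)) r)
            (evacuation-occ n (promote (x ∷ w)) (trans (length-promote x w) (suc-injective len)) r) ⟩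
  occ r (promote (x ∷ w)) + δ (vacated (x ∷ w)) r
    ≡⟨ Δ-occ x w r ⟩
  occ r (x ∷ w) ∎
  where open ≡-Reasoning

content-evacuation : ∀ n w → length w ≡ n → content (evacuation n w) ≗ content w
content-evacuation n w len r =
  trans (content-occ (evacuation n w) r) (trans (evacuation-occ n w len r) (sym (content-occ w r)))

Δ-evacuation-∷ʳ : ∀ n v y → length v ≡ n → Δ (evacuation (suc n) (v ∷ʳ y)) ≡ (evacuation n v , y)
Δ-evacuation-∷ʳ zero    []      y _   = refl
Δ-evacuation-∷ʳ (suc m) (x ∷ v) y len = begin
  Δ (evacuation (suc m) (promote ((x ∷ v) ∷ʳ y)) ∷ʳ vacated ((x ∷ v) ∷ʳ y))
    ≡⟨ cong (λ p → Δ (evacuation (suc m) (proj₁ p) ∷ʳ proj₂ p)) (Δ-∷ʳ (x ∷ v) y λ ()) ⟩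
  Δ (E ∷ʳ b)
    ≡⟨ Δ-∷ʳ E b (∷ʳ≢[] (evacuation m (promote (O ∷ʳ a))) (vacated (O ∷ʳ a))) ⟩
  slideStep ∅ (Δ E) b
    ≡⟨ cong (λ p → slideStep ∅ p b) (Δ-evacuation-∷ʳ m O a lenO) ⟩
  map₁ (evacuation m O ∷ʳ_) (switch (content (evacuation m O)) a b)
    ≡⟨ cong (map₁ (evacuation m O ∷ʳ_)) (switch-cong (content-evacuation m O lenO) a b) ⟩
  map₁ (evacuation m O ∷ʳ_) (switch (content O) a b)
    ≡⟨ cong (map₁ (evacuation m O ∷ʳ_)) (switch-involutive (content O) (vacated (x ∷ v)) y) ⟩
  (evacuation (suc m) (x ∷ v) , y) ∎
  where
  open ≡-Reasoning
  O = promote (x ∷ v)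
  lenO : length O ≡ m
  lenO = trans (length-promote x v) (suc-injective len)
  a = proj₁ (switch (content O) (vacated (x ∷ v)) y)
  b = proj₂ (switch (content O) (vacated (x ∷ v)) y)
  E = evacuation (suc m) (O ∷ʳ a)

evacuation-involutive : ∀ n w → length w ≡ n → evacuation n (evacuation n w) ≡ w
evacuation-involutive n w = go n (reverseView w)
  where
  go : ∀ n {w} → Reverse w → length w ≡ n → evacuation n (evacuation n w) ≡ w
  go zero    []            _   = refl
  go zero    (v ∶ _ ∶ʳ y)  len = ⊥-elim (1+n≢0 (trans (sym (length-∷ʳ v y)) len))
  go (suc n) []            ()
  go (suc n) (v ∶ rv ∶ʳ y) len =
    cong₂ _∷ʳ_ (trans (cong (evacuation n ∘ proj₁) Δ≡) (go n rv lenv)) (cong proj₂ Δ≡)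
    where
    lenv : length v ≡ n
    lenv = suc-injective (trans (sym (length-∷ʳ v y)) len)
    Δ≡ : Δ (evacuation (suc n) (v ∷ʳ y)) ≡ (evacuation n v , y)
    Δ≡ = Δ-evacuation-∷ʳ n v y lenv

-- Switches on lattice words

data SwitchView (c : Content) (a : ℕ) : ℕ → ℕ × ℕ → Set where
  swap    : ∀ {b} → a ≢ b → T (addable c b) → SwitchView c a b (b , a)
  equal   : SwitchView c a a (a , a)
  blocked : ∀ {b} → addable c b ≡ false → SwitchView c a b (a , b)

switch-view : ∀ c a b → T (addable c a) → SwitchView c a b (switch c a b)
switch-view c a b add-a with a ≡ᵇ b in a≡ᵇb
... | true with refl ← ≡ᵇ⇒≡ a b (subst T (sym a≡ᵇb) _) = equal
... | false rewrite Equivalence.to T-≡ add-a with addable c b in add-b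
...   | true  = swap (subst T a≡ᵇb ∘ ≡⇒≡ᵇ a b) (subst T (sym add-b) _)
...   | false = blocked add-b

switch-addable : ∀ {c} a b → Decreasing c → T (addable c a) → T (addable (c ⊕ a) b) →
  let (out , carry) = switch c a b in T (addable c out) × T (addable (c ⊕ out) carry)
switch-addable {c} a b dec add-a add-b with switch c a b | switch-view c a b add-a
... | _ | swap a≢b add-b[c] =
  add-b[c] , Decreasing-⊕⇒addable a (Decreasing-⊕ b dec add-b[c])
    (Decreasing-cong (⊕-comm c a b) (Decreasing-⊕ b (Decreasing-⊕ a dec add-a) add-b))
... | _ | equal     = add-a , add-b
... | _ | blocked _ = add-a , add-b

switch-ascent : ∀ {c} a b b′ → Decreasing c →
  T (addable c a) → T (addable (c ⊕ a) b) → T (addable (c ⊕ a ⊕ b) b′) →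
  let (out , carry) = switch c a b in (b <ᵇ b′) ≡ (out <ᵇ proj₁ (switch (c ⊕ out) carry b′))
switch-ascent {c} a b b′ dec add-a add-b add-b′ with switch c a b | switch-view c a b add-a
... | _ | swap a≢b add-b[c]
  with switch (c ⊕ b) a b′ | switch-view (c ⊕ b) a b′ (addable-⊕-≢ a b add-a a≢b)
...   | _ | swap _ _ = refl
...   | _ | equal    = refl
...   | _ | blocked blocked-b′
  with refl ← addable-⊕⇒≡suc a b′ (Decreasing-⊕ b dec add-b[c]) blocked-b′
                (subst T (addable-cong (⊕-comm c a b) b′) add-b′)
  = <ᵇ-suc-≢ b a (≢-sym a≢b)
switch-ascent {c} a b b′ dec add-a add-b add-b′ | _ | equal
  with switch (c ⊕ a) a b′ | switch-view (c ⊕ a) a b′ add-b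
...   | _ | swap _ _ = refl
...   | _ | equal    = refl
...   | _ | blocked blocked-b′
  with refl ← addable-⊕⇒≡suc a b′ (Decreasing-⊕ a dec add-a) blocked-b′ add-b′
  = ⊥-elim (subst T blocked-b′ (addable-⊕-suc a dec))
switch-ascent {c} a b b′ dec add-a add-b add-b′ | _ | blocked blocked-b
  with refl ← addable-⊕⇒≡suc a b dec blocked-b add-b
  with switch (c ⊕ a) (suc a) b′ | switch-view (c ⊕ a) (suc a) b′ add-b
...   | _ | swap a≢b′ _ = suc-<ᵇ-≢ a b′ (≢-sym a≢b′)
...   | _ | equal       = ⊥-elim (subst T (trans (addable-⊕-⊕-suc c a) blocked-b) add-b′)
...   | _ | blocked blocked-b′
  with refl ← addable-⊕⇒≡suc (suc a) b′ (Decreasing-⊕ a dec add-a) blocked-b′ add-b′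
  = refl

latticeFrom-slide : ∀ {c} a w → Decreasing c → T (addable c a) → T (latticeFrom (c ⊕ a) w) →
                    T (latticeFrom c (proj₁ (slide c a w)))
latticeFrom-slide a []      _   _     _   = _
latticeFrom-slide {c} a (b ∷ w) dec add-a lat
  with add-b , lat′ ← latticeFrom-∷⁻ b w lat
  with add-out , add-carry ← switch-addable a b dec add-a add-b =
  T-∧⁺ add-out (latticeFrom-slide carry w (Decreasing-⊕ out dec add-out) add-carry
    (subst T (latticeFrom-cong (switch-⊕ c a b) w) lat′))
  where
  out = proj₁ (switch c a b)
  carry = proj₂ (switch c a b)

lattice-promote : ∀ x w → Lattice (x ∷ w) → Lattice (promote (x ∷ w))
lattice-promote x w lat with add-x , lat′ ← latticeFrom-∷⁻ x w lat =
  latticeFrom-slide x w Decreasing-∅ add-x lat′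

lattice-Δ : ∀ x w → Lattice (x ∷ w) → Lattice (promote (x ∷ w) ∷ʳ vacated (x ∷ w))
lattice-Δ x w lat = lattice-∷ʳ⁺ (promote (x ∷ w)) (vacated (x ∷ w)) lat-p
  (Decreasing-⊕⇒addable (vacated (x ∷ w)) (Lattice⇒Decreasing (promote (x ∷ w)) lat-p)
    (Decreasing-cong (sym ∘ content-Δ (x ∷ w) λ ()) (Lattice⇒Decreasing (x ∷ w) lat)))
  where
  lat-p = lattice-promote x w lat

lattice-Δ-∷ʳ : ∀ v y → v ≢ [] → Lattice (v ∷ʳ y) →
  let p = promote v
      (c , d) = switch (content p) (vacated v) y
  in Lattice (p ∷ʳ c ∷ʳ d) × (content (p ∷ʳ c) ⊕ d ≗ content (v ∷ʳ y))
lattice-Δ-∷ʳ []      y v≢[] _   = ⊥-elim (v≢[] refl)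
lattice-Δ-∷ʳ (x ∷ w) y _    lat =
  subst (λ s → Lattice (proj₁ s ∷ʳ proj₂ s)) Δ≡ (lattice-Δ x (w ∷ʳ y) lat) ,
  λ r → trans (cong (λ s → content (proj₁ s) r + δ (proj₂ s) r) (sym Δ≡))
              (content-Δ (x ∷ w ∷ʳ y) (λ ()) r)
  where
  Δ≡ = Δ-∷ʳ (x ∷ w) y λ ()

lattice-evacuation : ∀ n w → length w ≡ n → Lattice w → Lattice (evacuation n w)
lattice-evacuation zero    w       _   _   = _
lattice-evacuation (suc n) (x ∷ w) len lat =
  lattice-∷ʳ⁺ (evacuation n O) (vacated (x ∷ w)) (lattice-evacuation n O lenO (lattice-promote x w lat))
    (subst T (sym (addable-cong (content-evacuation n O lenO) (vacated (x ∷ w))))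
      (proj₂ (lattice-∷ʳ⁻ O (vacated (x ∷ w)) (lattice-Δ x w lat))))
  where
  O = promote (x ∷ w)
  lenO : length O ≡ n
  lenO = trans (length-promote x w) (suc-injective len)

-- Ascents under promotion and evacuation

ascents : List ℕ → List Bool
ascents []          = []
ascents (x ∷ [])    = []
ascents (x ∷ y ∷ w) = (x <ᵇ y) ∷ ascents (y ∷ w)

ascents-∷ʳ-∷ʳ : ∀ w a b → ascents (w ∷ʳ a ∷ʳ b) ≡ ascents (w ∷ʳ a) ∷ʳ (a <ᵇ b)
ascents-∷ʳ-∷ʳ []          a b = refl
ascents-∷ʳ-∷ʳ (x ∷ [])    a b = refl
ascents-∷ʳ-∷ʳ (x ∷ y ∷ w) a b = cong ((x <ᵇ y) ∷_) (ascents-∷ʳ-∷ʳ (y ∷ w) a b)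

length-ascents : ∀ w → length (ascents w) ≡ length w ∸ 1
length-ascents []          = refl
length-ascents (x ∷ [])    = refl
length-ascents (x ∷ y ∷ w) = cong suc (length-ascents (y ∷ w))

ascents-slide : ∀ {c} a b w → Decreasing c → T (addable c a) → T (latticeFrom (c ⊕ a) (b ∷ w)) →
                ascents (proj₁ (slide c a (b ∷ w))) ≡ ascents (b ∷ w)
ascents-slide a b []       _   _     _   = refl
ascents-slide {c} a b (b′ ∷ w) dec add-a lat
  with add-b , lat′ ← latticeFrom-∷⁻ b (b′ ∷ w) lat
  with add-out , add-carry ← switch-addable a b dec add-a add-b =
  cong₂ _∷_ (sym (switch-ascent a b b′ dec add-a add-b (proj₁ (latticeFrom-∷⁻ b′ w lat′))))
    (ascents-slide carry b′ w (Decreasing-⊕ out dec add-out) add-carry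
      (subst T (latticeFrom-cong (switch-⊕ c a b) (b′ ∷ w)) lat′))
  where
  out = proj₁ (switch c a b)
  carry = proj₂ (switch c a b)

ascents-promote : ∀ x w → Lattice (x ∷ w) → ascents (promote (x ∷ w)) ≡ ascents w
ascents-promote x []      _   = refl
ascents-promote x (b ∷ w) lat with add-x , lat′ ← latticeFrom-∷⁻ x (b ∷ w) lat =
  ascents-slide x b w Decreasing-∅ add-x lat′

-- Both sides are the last two letters read off a double promotion of u ∷ʳ y; inverting
-- the two final switches turns one comparison into the other (switch-ascent).
vacated-promote-∷ʳ : ∀ x₁ x₂ r y → Lattice ((x₁ ∷ x₂ ∷ r) ∷ʳ y) →
  (vacated (promote ((x₁ ∷ x₂ ∷ r) ∷ʳ y)) <ᵇ vacated ((x₁ ∷ x₂ ∷ r) ∷ʳ y))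
  ≡ (vacated (promote (x₁ ∷ x₂ ∷ r)) <ᵇ vacated (x₁ ∷ x₂ ∷ r))
vacated-promote-∷ʳ x₁ x₂ r y lat = begin
  vacated (promote (u ∷ʳ y)) <ᵇ vacated (u ∷ʳ y)
    ≡⟨ cong₂ _<ᵇ_ (cong (vacated ∘ proj₁) Δu) (cong proj₂ Δu) ⟩
  vacated (p ∷ʳ c) <ᵇ d
    ≡⟨ cong (λ s → proj₂ s <ᵇ d) Δp ⟩
  d′ <ᵇ d
    ≡⟨ switch-ascent c′ d′ d (Lattice⇒Decreasing q lat-q) add-c′ add-d′ add-d ⟩
  proj₁ (switch K c′ d′) <ᵇ proj₁ (switch (K ⊕ proj₁ (switch K c′ d′)) (proj₂ (switch K c′ d′)) d)
    ≡⟨ cong (λ s → proj₁ s <ᵇ proj₁ (switch (K ⊕ proj₁ s) (proj₂ s) d)) (switch-involutive K f c) ⟩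
  f <ᵇ proj₁ (switch (K ⊕ f) c d)
    ≡⟨ cong (λ s → f <ᵇ proj₁ s) (switch-cong (content-Δ p λ ()) c d) ⟩
  f <ᵇ proj₁ (switch (content p) c d)
    ≡⟨ cong (λ s → f <ᵇ proj₁ s) (switch-involutive (content p) e y) ⟩
  f <ᵇ e ∎
  where
  open ≡-Reasoning
  u = x₁ ∷ x₂ ∷ r
  p = promote u
  e = vacated u
  c = proj₁ (switch (content p) e y)
  d = proj₂ (switch (content p) e y)
  q = promote p
  f = vacated p
  K = content q
  c′ = proj₁ (switch K f c)
  d′ = proj₂ (switch K f c)
  Δu : Δ (u ∷ʳ y) ≡ (p ∷ʳ c , d)
  Δu = Δ-∷ʳ u y λ ()
  Δp : Δ (p ∷ʳ c) ≡ (q ∷ʳ c′ , d′)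
  Δp = Δ-∷ʳ p c λ ()
  lat-pcd : Lattice (p ∷ʳ c ∷ʳ d)
  lat-pcd = proj₁ (lattice-Δ-∷ʳ u y (λ ()) lat)
  Δp-facts = lattice-Δ-∷ʳ p c (λ ()) (proj₁ (lattice-∷ʳ⁻ (p ∷ʳ c) d lat-pcd))
  lat-qc′ : Lattice (q ∷ʳ c′)
  lat-qc′ = proj₁ (lattice-∷ʳ⁻ (q ∷ʳ c′) d′ (proj₁ Δp-facts))
  lat-q : Lattice q
  lat-q = proj₁ (lattice-∷ʳ⁻ q c′ lat-qc′)
  add-c′ : T (addable K c′)
  add-c′ = proj₂ (lattice-∷ʳ⁻ q c′ lat-qc′)
  add-d′ : T (addable (K ⊕ c′) d′)
  add-d′ = subst T (addable-cong (content-∷ʳ q c′) d′)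
                   (proj₂ (lattice-∷ʳ⁻ (q ∷ʳ c′) d′ (proj₁ Δp-facts)))
  add-d : T (addable (K ⊕ c′ ⊕ d′) d)
  add-d = subst T (addable-cong content-pc d) (proj₂ (lattice-∷ʳ⁻ (p ∷ʳ c) d lat-pcd))
    where
    content-pc : content (p ∷ʳ c) ≗ K ⊕ c′ ⊕ d′
    content-pc r = trans (sym (proj₂ Δp-facts r)) (cong (_+ δ d′ r) (content-∷ʳ q c′ r))

vacated-promote-<ᵇ : ∀ x₁ x₂ r → Lattice (x₁ ∷ x₂ ∷ r) →
  (vacated (promote (x₁ ∷ x₂ ∷ r)) <ᵇ vacated (x₁ ∷ x₂ ∷ r)) ≡ (x₁ <ᵇ x₂)
vacated-promote-<ᵇ x₁ x₂ r = go (reverseView r)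
  where
  go : ∀ {r} → Reverse r → Lattice (x₁ ∷ x₂ ∷ r) →
       (vacated (promote (x₁ ∷ x₂ ∷ r)) <ᵇ vacated (x₁ ∷ x₂ ∷ r)) ≡ (x₁ <ᵇ x₂)
  go []            _   = cong (λ s → proj₁ s <ᵇ proj₂ s) (switch-∅ x₁ x₂)
  go (r ∶ rr ∶ʳ y) lat =
    trans (vacated-promote-∷ʳ x₁ x₂ r y lat) (go rr (proj₁ (lattice-∷ʳ⁻ (x₁ ∷ x₂ ∷ r) y lat)))

ascents-evacuation : ∀ n w → length w ≡ n → Lattice w → ascents (evacuation n w) ≡ reverse (ascents w)
ascents-evacuation zero          []          _   _   = refl
ascents-evacuation (suc zero)    (x ∷ [])    _   _   = refl
ascents-evacuation (suc (suc k)) (x ∷ y ∷ r) len lat = begin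
  ascents (evacuation k (promote O) ∷ʳ vacated O ∷ʳ vacated w)
    ≡⟨ ascents-∷ʳ-∷ʳ (evacuation k (promote O)) (vacated O) (vacated w) ⟩
  ascents (evacuation (suc k) O) ∷ʳ (vacated O <ᵇ vacated w)
    ≡⟨ cong₂ _∷ʳ_ (ascents-evacuation (suc k) O lenO (lattice-promote x (y ∷ r) lat))
                  (vacated-promote-<ᵇ x y r lat) ⟩
  reverse (ascents O) ∷ʳ (x <ᵇ y)
    ≡⟨ cong (λ a → reverse a ∷ʳ (x <ᵇ y)) (ascents-promote x (y ∷ r) lat) ⟩
  reverse (ascents (y ∷ r)) ∷ʳ (x <ᵇ y)
    ≡⟨ unfold-reverse (x <ᵇ y) (ascents (y ∷ r)) ⟨
  reverse (ascents w) ∎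
  where
  open ≡-Reasoning
  w = x ∷ y ∷ r
  O = promote w
  lenO : length O ≡ suc k
  lenO = trans (length-promote x (y ∷ r)) (suc-injective len)

-- Integer ranges and positions

InRange : ℕ → ℕ → ℕ → Set
InRange k m i = k ≤ i × i < k + m

inRange? : ∀ k m → Decidable (InRange k m)
inRange? k m i = (k ≤? i) ×-dec (i <? k + m)

InRange-empty : ∀ {k i} → ¬ InRange k 0 i
InRange-empty {k} (k≤i , i<k+0) = <⇒≱ (subst (_ <_) (+-identityʳ k) i<k+0) k≤i

InRange-head : ∀ k m → InRange k (suc m) k
InRange-head k m = ≤-refl , m<m+n k z<s

InRange-tail : ∀ {k m i} → i ≢ k → InRange k (suc m) i → InRange (suc k) m i
InRange-tail {k} {m} {i} i≢k (k≤i , i<) = ≤∧≢⇒< k≤i (≢-sym i≢k) , subst (i <_) (+-suc k m) i<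

InRange-suc : ∀ {k m i} → InRange (suc k) m i → InRange k (suc m) i
InRange-suc {k} {m} {i} (k<i , i<) = <⇒≤ k<i , subst (i <_) (sym (+-suc k m)) i<

All-iterate : ∀ {P : ℕ → Set} k m → (∀ i → InRange k m i → P i) → All P (iterate suc k m)
All-iterate k zero    h = []
All-iterate k (suc m) h = h k (InRange-head k m) ∷ All-iterate (suc k) m (λ i → h i ∘ InRange-suc)

All-iterate⁻ : ∀ {P : ℕ → Set} k m → All P (iterate suc k m) → ∀ i → InRange k m i → P i
All-iterate⁻ k zero    _         i i∈ = ⊥-elim (InRange-empty i∈)
All-iterate⁻ k (suc m) (pk ∷ ps) i i∈ with i ≟ k
... | yes refl = pk
... | no  i≢k  = All-iterate⁻ (suc k) m ps i (InRange-tail i≢k i∈)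

oneTo≡iterate : ∀ n → oneTo n ≡ iterate suc 1 n
oneTo≡iterate n = trans (map-applyUpTo id suc n) (go suc 1 n λ _ → refl)
  where
  go : ∀ f k m → (∀ i → f i ≡ k + i) → applyUpTo f m ≡ iterate suc k m
  go f k zero    _  = refl
  go f k (suc m) fi = cong₂ _∷_ (trans (fi 0) (+-identityʳ k))
                                (go (f ∘ suc) (suc k) m λ i → trans (fi (suc i)) (+-suc k i))

map-iterate≡tabulate : ∀ {A : Set} (g : ℕ → A) k m →
                       map g (iterate suc k m) ≡ tabulate (λ (s : Fin m) → g (k + toℕ s))
map-iterate≡tabulate g k zero    = refl
map-iterate≡tabulate g k (suc m) = cong₂ _∷_ (cong g (sym (+-identityʳ k)))
  (trans (map-iterate≡tabulate g (suc k) m) (tabulate-cong λ s → cong g (sym (+-suc k (toℕ s)))))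

positions : ℕ → List Bool → List ℕ
positions k []       = []
positions k (b ∷ bs) = if b then k ∷ positions (suc k) bs else positions (suc k) bs

positions-bounded : ∀ k bs → All (InRange k (length bs)) (positions k bs)
positions-bounded k []           = []
positions-bounded k (true ∷ bs)  = InRange-head k (length bs) ∷ All.map InRange-suc (positions-bounded (suc k) bs)
positions-bounded k (false ∷ bs) = All.map InRange-suc (positions-bounded (suc k) bs)

positions-∷ʳ : ∀ k bs b →
  positions k (bs ∷ʳ b) ≡ positions k bs ++ (if b then (k + length bs) ∷ [] else [])
positions-∷ʳ k []        true  = cong (_∷ []) (sym (+-identityʳ k))
positions-∷ʳ k []        false = refl
positions-∷ʳ k (b′ ∷ bs) b rewrite positions-∷ʳ (suc k) bs b | +-suc k (length bs) with b′
... | true  = refl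
... | false = refl

filter-iterate : ∀ {P : ℕ → Set} (P? : Decidable P) k m →
  filter P? (iterate suc k m) ≡ positions k (map (does ∘ P?) (iterate suc k m))
filter-iterate P? k zero    = refl
filter-iterate P? k (suc m) with does (P? k)
... | true  = cong (k ∷_) (filter-iterate P? (suc k) m)
... | false = filter-iterate P? (suc k) m

occ-positions-suc : ∀ k bs → occ k (positions (suc k) bs) ≡ 0
occ-positions-suc k bs =
  occ-All-≢ k _ (All.map (λ (k<i , _) → ≢-sym (<⇒≢ k<i)) (positions-bounded (suc k) bs))

occ-positions-∷ : ∀ i k b bs →
  occ i (positions k (b ∷ bs)) ≡ (if b then δ k i else 0) + occ i (positions (suc k) bs)
occ-positions-∷ i k true  bs = occ-∷ i k (positions (suc k) bs)
occ-positions-∷ i k false bs = refl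

strictInc-∷ : ∀ k L → All (k <_) L → T (strictInc L) → T (strictInc (k ∷ L))
strictInc-∷ k []      _         _   = _
strictInc-∷ k (x ∷ L) (k<x ∷ _) inc = T-∧⁺ (<⇒<ᵇ k<x) inc

strictInc-∷⁻ : ∀ k L → T (strictInc (k ∷ L)) → All (k <_) L × T (strictInc L)
strictInc-∷⁻ k []      _   = [] , _
strictInc-∷⁻ k (x ∷ L) inc with k<ᵇx , inc′ ← T-∧⁻ {k <ᵇ x} inc =
  <ᵇ⇒< k x k<ᵇx ∷ All.map (<-trans (<ᵇ⇒< k x k<ᵇx)) (proj₁ (strictInc-∷⁻ x L inc′)) , inc′

positions-strictInc : ∀ k bs → T (strictInc (positions k bs))
positions-strictInc k []           = _
positions-strictInc k (true ∷ bs)  =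
  strictInc-∷ k _ (All.map proj₁ (positions-bounded (suc k) bs)) (positions-strictInc (suc k) bs)
positions-strictInc k (false ∷ bs) = positions-strictInc (suc k) bs

_∈ᵇ_ : ℕ → List ℕ → Bool
i ∈ᵇ r = does (i ∈? r)

∈ᵇ-occ : ∀ i L → i ∈ᵇ L ≡ (0 <ᵇ occ i L)
∈ᵇ-occ i []      = refl
∈ᵇ-occ i (x ∷ L) rewrite ≡ᵇ-sym i x with x ≡ᵇ i
... | true  = refl
... | false = ∈ᵇ-occ i L

∈ᵇ⇒occ>0 : ∀ i L → i ∈ᵇ L ≡ true → 0 < occ i L
∈ᵇ⇒occ>0 i L i∈L = <ᵇ⇒< 0 (occ i L) (subst T (trans (sym i∈L) (∈ᵇ-occ i L)) _)

∉ᵇ⇒occ≡0 : ∀ i L → i ∈ᵇ L ≡ false → occ i L ≡ 0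
∉ᵇ⇒occ≡0 i L i∉L =
  n≤0⇒n≡0 (≮⇒≥ λ 0<occ → subst T (trans (sym (∈ᵇ-occ i L)) i∉L) (<⇒<ᵇ 0<occ))

∉ᵇ-All-< : ∀ {k} L → All (k <_) L → k ∈ᵇ L ≡ false
∉ᵇ-All-< {k} L k<L = trans (∈ᵇ-occ k L) (cong (0 <ᵇ_) (occ-All-≢ k L (All.map (≢-sym ∘ <⇒≢) k<L)))

strictInc-positions : ∀ k m r → T (strictInc r) → All (InRange k m) r →
                      r ≡ positions k (map (_∈ᵇ r) (iterate suc k m))
strictInc-positions k zero    []      _   _          = refl
strictInc-positions k zero    (x ∷ r) _   (x∈ ∷ _)   = ⊥-elim (InRange-empty x∈)
strictInc-positions k (suc m) []      _   _          = strictInc-positions (suc k) m [] _ []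
strictInc-positions k (suc m) (x ∷ r) inc (x∈ ∷ r∈) with x ≟ k
... | yes refl rewrite ≡ᵇ-refl x =
  cong (x ∷_) (trans (strictInc-positions (suc x) m r (proj₂ (strictInc-∷⁻ x r inc)) (tail x<r r∈))
                     (cong (positions (suc x)) (map-cong-local (All-iterate (suc x) m λ i (x<i , _) →
                       cong (_∨ (i ∈ᵇ r)) (sym (≡ᵇ-≢ (≢-sym (<⇒≢ x<i))))))))
  where
  x<r = proj₁ (strictInc-∷⁻ x r inc)
  tail : ∀ {L} → All (x <_) L → All (InRange x (suc m)) L → All (InRange (suc x) m) L
  tail x<L L∈ = All.zipWith (λ (x<i , i∈) → InRange-tail (≢-sym (<⇒≢ x<i)) i∈) (x<L , L∈)
... | no x≢k with k<x ← ≤∧≢⇒< (proj₁ x∈) (≢-sym x≢k)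
  with k<x∷r ← k<x ∷ All.map (<-trans k<x) (proj₁ (strictInc-∷⁻ x r inc))
  rewrite ∉ᵇ-All-< (x ∷ r) k<x∷r =
  strictInc-positions (suc k) m (x ∷ r) inc
    (All.zipWith (λ (k<i , i∈) → InRange-tail (≢-sym (<⇒≢ k<i)) i∈) (k<x∷r , x∈ ∷ r∈))

sum-δ-out : ∀ x k m → ¬ InRange k m x → sum (map (δ x) (iterate suc k m)) ≡ 0
sum-δ-out x k zero    _ = refl
sum-δ-out x k (suc m) x∉ = cong₂ _+_ (δ-≢ x≢k) (sum-δ-out x (suc k) m (x∉ ∘ InRange-suc))
  where
  x≢k : x ≢ k
  x≢k refl = x∉ (InRange-head x m)

sum-δ-in : ∀ x k m → InRange k m x → sum (map (δ x) (iterate suc k m)) ≡ 1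
sum-δ-in x k zero    x∈ = ⊥-elim (InRange-empty x∈)
sum-δ-in x k (suc m) x∈ with x ≟ k
... | yes refl = cong₂ _+_ (δ-self x) (sum-δ-out x (suc x) m λ (x<x , _) → <-irrefl refl x<x)
... | no  x≢k  = cong₂ _+_ (δ-≢ x≢k) (sum-δ-in x (suc k) m (InRange-tail x≢k x∈))

sum-map-+ : ∀ (f g : ℕ → ℕ) xs → sum (map (λ i → f i + g i) xs) ≡ sum (map f xs) + sum (map g xs)
sum-map-+ f g []       = refl
sum-map-+ f g (x ∷ xs) =
  trans (cong (f x + g x +_) (sum-map-+ f g xs)) (interchange (f x) (g x) (sum (map f xs)) (sum (map g xs)))

sum-map-iterate-1 : ∀ (f : ℕ → ℕ) k m → (∀ i → InRange k m i → f i ≡ 1) →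
                    sum (map f (iterate suc k m)) ≡ m
sum-map-iterate-1 f k zero    _   = refl
sum-map-iterate-1 f k (suc m) f≡1 =
  cong₂ _+_ (f≡1 k (InRange-head k m)) (sum-map-iterate-1 f (suc k) m λ i → f≡1 i ∘ InRange-suc)

sum-occ-∷ : ∀ x L xs →
  sum (map (λ i → occ i (x ∷ L)) xs) ≡ sum (map (δ x) xs) + sum (map (λ i → occ i L) xs)
sum-occ-∷ x L xs = trans (cong sum (map-cong (λ i → occ-∷ i x L) xs)) (sum-map-+ (δ x) (λ i → occ i L) xs)

sum-occ-iterate : ∀ k m L → sum (map (λ i → occ i L) (iterate suc k m)) ≡ length (filter (inRange? k m) L)
sum-occ-iterate k m []      = sum-map-iterate-0 (iterate suc k m)
  where
  sum-map-iterate-0 : ∀ xs → sum (map (λ _ → 0) xs) ≡ 0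
  sum-map-iterate-0 []       = refl
  sum-map-iterate-0 (_ ∷ xs) = sum-map-iterate-0 xs
sum-occ-iterate k m (x ∷ L) with inRange? k m x
... | yes x∈ = trans (sum-occ-∷ x L (iterate suc k m))
  (trans (cong₂ _+_ (sum-δ-in x k m x∈) (sum-occ-iterate k m L))
         (cong length (sym (filter-accept (inRange? k m) x∈))))
... | no  x∉ = trans (sum-occ-∷ x L (iterate suc k m))
  (trans (cong₂ _+_ (sum-δ-out x k m x∉) (sum-occ-iterate k m L))
         (cong length (sym (filter-reject (inRange? k m) x∉))))

count-complete : ∀ k m L → sum (map (λ i → occ i L) (iterate suc k m)) ≡ length L → All (InRange k m) L
count-complete k m L counted =
  subst (All (InRange k m)) (filter-complete (inRange? k m) (trans (sym (sum-occ-iterate k m L)) counted))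
        (all-filter (inRange? k m) L)

-- The tableau of a word and the row word of a tableau

cells : ℕ → ℕ → List ℕ → List ℕ
cells k s u = positions k (map (_≡ᵇ s) u)

tableau : ℕ → List ℕ → Filling
tableau R u = map (λ s → cells 1 s u) (iterate suc 0 R)

rowWord : Filling → ℕ → List ℕ
rowWord t n = map (λ i → rowOf i t) (iterate suc 1 n)

length-cells : ∀ k s u → length (cells k s u) ≡ occ s u
length-cells k s []      = refl
length-cells k s (x ∷ u) with x ≡ᵇ s
... | true  = cong suc (length-cells (suc k) s u)
... | false = length-cells (suc k) s u

map-length-tableau : ∀ R u → map length (tableau R u) ≡ map (λ s → occ s u) (iterate suc 0 R)
map-length-tableau R u =
  trans (sym (map-∘ (iterate suc 0 R))) (map-cong (λ s → length-cells 1 s u) (iterate suc 0 R))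

occ-cells-head : ∀ k s x u → occ k (cells k s (x ∷ u)) ≡ δ x s
occ-cells-head k s x u
  rewrite occ-positions-∷ k k (x ≡ᵇ s) (map (_≡ᵇ s) u) | δ-self k | occ-positions-suc k (map (_≡ᵇ s) u) =
  +-identityʳ (δ x s)

occ-cells-tail : ∀ {i k} s x u → i ≢ k → occ i (cells k s (x ∷ u)) ≡ occ i (cells (suc k) s u)
occ-cells-tail {i} {k} s x u i≢k
  rewrite occ-positions-∷ i k (x ≡ᵇ s) (map (_≡ᵇ s) u) | δ-≢ (≢-sym i≢k) with x ≡ᵇ s
... | true  = refl
... | false = refl

rowOf-map-cong : ∀ i j (g h : ℕ → List ℕ) xs → (∀ s → occ i (g s) ≡ occ j (h s)) →
                 rowOf i (map g xs) ≡ rowOf j (map h xs)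
rowOf-map-cong i j g h []       _  = refl
rowOf-map-cong i j g h (s ∷ xs) eq rewrite ∈ᵇ-occ i (g s) | ∈ᵇ-occ j (h s) | eq s =
  cong (if 0 <ᵇ occ j (h s) then 0 else_) (cong suc (rowOf-map-cong i j g h xs eq))

rowOf-δ : ∀ i (g : ℕ → List ℕ) k R x → (∀ s → occ i (g s) ≡ δ x s) → InRange k R x →
          rowOf i (map g (iterate suc k R)) ≡ x ∸ k
rowOf-δ i g k zero    x _     x∈ = ⊥-elim (InRange-empty x∈)
rowOf-δ i g k (suc R) x occ≡δ x∈ rewrite ∈ᵇ-occ i (g k) | occ≡δ k with x ≟ k
... | yes refl rewrite δ-self x = sym (n∸n≡0 x)
... | no  x≢k  rewrite δ-≢ x≢k =
  trans (cong suc (rowOf-δ i g (suc k) R x occ≡δ (InRange-tail x≢k x∈)))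
        (sym (+-∸-assoc 1 (proj₁ (InRange-tail x≢k x∈))))

rowWord-cells : ∀ k R u → All (_< R) u →
  map (λ i → rowOf i (map (λ s → cells k s u) (iterate suc 0 R))) (iterate suc k (length u)) ≡ u
rowWord-cells k R []      _           = refl
rowWord-cells k R (x ∷ u) (x<R ∷ u<R) = cong₂ _∷_
  (rowOf-δ k (λ s → cells k s (x ∷ u)) 0 R x (λ s → occ-cells-head k s x u) (z≤n , x<R))
  (trans (map-cong-local (All-iterate (suc k) (length u) λ i (k<i , _) →
            rowOf-map-cong i i _ _ (iterate suc 0 R) (λ s → occ-cells-tail s x u (≢-sym (<⇒≢ k<i)))))
         (rowWord-cells (suc k) R u u<R))

occ-concat : ∀ i (t : Filling) → occ i (concat t) ≡ sum (map (occ i) t)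
occ-concat i []      = refl
occ-concat i (r ∷ t) = trans (occ-++ i r (concat t)) (cong (occ i r +_) (occ-concat i t))

sum-occ-cells : ∀ k R u → All (_< R) u → ∀ i → InRange k (length u) i →
                sum (map (λ s → occ i (cells k s u)) (iterate suc 0 R)) ≡ 1
sum-occ-cells k R []      _           i i∈ = ⊥-elim (InRange-empty i∈)
sum-occ-cells k R (x ∷ u) (x<R ∷ u<R) i i∈ with i ≟ k
... | yes refl =
  trans (cong sum (map-cong (λ s → occ-cells-head i s x u) (iterate suc 0 R))) (sum-δ-in x 0 R (z≤n , x<R))
... | no  i≢k  =
  trans (cong sum (map-cong (λ s → occ-cells-tail s x u i≢k) (iterate suc 0 R)))
        (sum-occ-cells (suc k) R u u<R i (InRange-tail i≢k i∈))

-- Column strictness of the tableau of a word is the lattice property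

colInc-∷ʳ-upper : ∀ U L N → All (_< N) L → colInc (U ∷ʳ N) L ≡ colInc U L
colInc-∷ʳ-upper []      []      N _         = refl
colInc-∷ʳ-upper []      (y ∷ L) N (y<N ∷ _) rewrite ≤⇒≮ᵇ (<⇒≤ y<N) = refl
colInc-∷ʳ-upper (x ∷ U) []      N _         = refl
colInc-∷ʳ-upper (x ∷ U) (y ∷ L) N (_ ∷ L<N) = cong ((x <ᵇ y) ∧_) (colInc-∷ʳ-upper U L N L<N)

colInc-∷ʳ-lower : ∀ U L N → All (_< N) U → colInc U (L ∷ʳ N) ≡ colInc U L ∧ (length L <ᵇ length U)
colInc-∷ʳ-lower []      []      N _         = refl
colInc-∷ʳ-lower []      (y ∷ L) N _         = refl
colInc-∷ʳ-lower (x ∷ U) []      N (x<N ∷ _) =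
  trans (∧-identityʳ (x <ᵇ N)) (Equivalence.to T-≡ (<⇒<ᵇ x<N))
colInc-∷ʳ-lower (x ∷ U) (y ∷ L) N (_ ∷ U<N) rewrite colInc-∷ʳ-lower U L N U<N =
  sym (∧-assoc (x <ᵇ y) (colInc U L) (length L <ᵇ length U))

newCell : ℕ → ℕ → ℕ → List ℕ
newCell N x s = if x ≡ᵇ s then N ∷ [] else []

cells-∷ʳ : ∀ k s v x → cells k s (v ∷ʳ x) ≡ cells k s v ++ newCell (k + length v) x s
cells-∷ʳ k s v x rewrite map-++ (_≡ᵇ s) v (x ∷ []) =
  trans (positions-∷ʳ k (map (_≡ᵇ s) v) (x ≡ᵇ s))
        (cong (λ m → cells k s v ++ newCell (k + m) x s) (length-map (_≡ᵇ s) v))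

cells-bounded : ∀ k s v → All (_< k + length v) (cells k s v)
cells-bounded k s v =
  All.map (λ {i} (_ , i<) → subst (i <_) (cong (k +_) (length-map (_≡ᵇ s) v)) i<)
          (positions-bounded k (map (_≡ᵇ s) v))

colInc-++-newCell : ∀ U L N x s → All (_< N) U → All (_< N) L →
  colInc (U ++ newCell N x s) (L ++ newCell N x (suc s))
  ≡ colInc U L ∧ (if x ≡ᵇ suc s then length L <ᵇ length U else true)
colInc-++-newCell U L N x s U<N L<N with x ≟ s | x ≟ suc s
... | yes refl | yes x≡1+x = ⊥-elim (1+n≢n (sym x≡1+x))
... | yes refl | no  x≢1+x rewrite ≡ᵇ-refl x | ≡ᵇ-≢ x≢1+x | ++-identityʳ L =
  trans (colInc-∷ʳ-upper U L N L<N) (sym (∧-identityʳ (colInc U L)))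
... | no  x≢s  | yes refl  rewrite ≡ᵇ-refl (suc s) | ≡ᵇ-≢ x≢s | ++-identityʳ U =
  colInc-∷ʳ-lower U L N U<N
... | no  x≢s  | no  x≢1+s rewrite ≡ᵇ-≢ x≢s | ≡ᵇ-≢ x≢1+s | ++-identityʳ U | ++-identityʳ L =
  sym (∧-identityʳ (colInc U L))

colsInc-map : ∀ (h : ℕ → List ℕ) k R →
  colsInc (map h (iterate suc k (suc R))) ≡ allB (λ s → colInc (h s) (h (suc s))) (iterate suc k R)
colsInc-map h k zero    = refl
colsInc-map h k (suc R) = cong (colInc (h k) (h (suc k)) ∧_) (colsInc-map h (suc k) R)

allB-cong : ∀ {A : Set} {p q : A → Bool} → p ≗ q → ∀ xs → allB p xs ≡ allB q xs
allB-cong p≗q []       = refl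
allB-cong p≗q (x ∷ xs) = cong₂ _∧_ (p≗q x) (allB-cong p≗q xs)

allB-∧ : ∀ {A : Set} (p q : A → Bool) xs → allB (λ a → p a ∧ q a) xs ≡ allB p xs ∧ allB q xs
allB-∧ p q []       = refl
allB-∧ p q (x ∷ xs) rewrite allB-∧ p q xs with p x | q x
... | true  | true  = refl
... | true  | false = sym (∧-zeroʳ (allB p xs))
... | false | _     = refl

allB-true : ∀ {A : Set} (xs : List A) → allB (λ _ → true) xs ≡ true
allB-true []       = refl
allB-true (_ ∷ xs) = allB-true xs

allB-if-≢ : ∀ (C : ℕ → Bool) y k R → y < k →
            allB (λ s → if y ≡ᵇ s then C s else true) (iterate suc k R) ≡ true
allB-if-≢ C y k zero    _   = refl
allB-if-≢ C y k (suc R) y<k rewrite ≡ᵇ-≢ (<⇒≢ y<k) = allB-if-≢ C y (suc k) R (m<n⇒m<1+n y<k)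

allB-if-≡ᵇ : ∀ (C : ℕ → Bool) y k R → InRange k R y →
             allB (λ s → if y ≡ᵇ s then C s else true) (iterate suc k R) ≡ C y
allB-if-≡ᵇ C y k zero    y∈ = ⊥-elim (InRange-empty y∈)
allB-if-≡ᵇ C y k (suc R) y∈ with y ≟ k
... | yes refl rewrite ≡ᵇ-refl y | allB-if-≢ C y (suc y) R (n<1+n y) = ∧-identityʳ (C y)
... | no  y≢k  rewrite ≡ᵇ-≢ y≢k = allB-if-≡ᵇ C y (suc k) R (InRange-tail y≢k y∈)

-- adding a cell in row x keeps the columns increasing iff row x - 1 is longer than row x
newCell-addable : ∀ R v x → x < suc R →
  allB (λ s → if x ≡ᵇ suc s then length (cells 1 (suc s) v) <ᵇ length (cells 1 s v) else true)
       (iterate suc 0 R)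
  ≡ addable (content v) x
newCell-addable R v zero    _       = allB-true (iterate suc 0 R)
newCell-addable R v (suc y) 1+y<1+R = begin
  allB (λ s → if y ≡ᵇ s then length (cells 1 (suc s) v) <ᵇ length (cells 1 s v) else true) (iterate suc 0 R)
    ≡⟨ allB-if-≡ᵇ (λ s → length (cells 1 (suc s) v) <ᵇ length (cells 1 s v)) y 0 R
                  (z≤n , ≤-pred 1+y<1+R) ⟩
  length (cells 1 (suc y) v) <ᵇ length (cells 1 y v)
    ≡⟨ cong₂ _<ᵇ_ (length-cells 1 (suc y) v) (length-cells 1 y v) ⟩
  occ (suc y) v <ᵇ occ y v
    ≡⟨ cong₂ _<ᵇ_ (content-occ v (suc y)) (content-occ v y) ⟨
  addable (content v) (suc y) ∎
  where open ≡-Reasoning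

colsInc-tableau : ∀ R u → All (_< R) u → colsInc (tableau R u) ≡ latticeFrom ∅ u
colsInc-tableau zero    []      _        = refl
colsInc-tableau zero    (x ∷ u) (() ∷ _)
colsInc-tableau (suc R) u       u<R      = go (reverseView u) u<R
  where
  g : List ℕ → ℕ → List ℕ
  g v s = cells 1 s v
  go : ∀ {u} → Reverse u → All (_< suc R) u → colsInc (tableau (suc R) u) ≡ latticeFrom ∅ u
  go []            _      = trans (colsInc-map (g []) 0 R) (allB-true (iterate suc 0 R))
  go (v ∶ rv ∶ʳ x) v∷x<R = begin
    colsInc (tableau (suc R) (v ∷ʳ x))
      ≡⟨ cong colsInc (map-cong (λ s → cells-∷ʳ 1 s v x) (iterate suc 0 (suc R))) ⟩
    colsInc (map (λ s → g v s ++ newCell N x s) (iterate suc 0 (suc R)))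
      ≡⟨ colsInc-map (λ s → g v s ++ newCell N x s) 0 R ⟩
    allB (λ s → colInc (g v s ++ newCell N x s) (g v (suc s) ++ newCell N x (suc s))) (iterate suc 0 R)
      ≡⟨ allB-cong (λ s → colInc-++-newCell (g v s) (g v (suc s)) N x s
                            (cells-bounded 1 s v) (cells-bounded 1 (suc s) v)) (iterate suc 0 R) ⟩
    allB (λ s → colInc (g v s) (g v (suc s)) ∧ newCellOK s) (iterate suc 0 R)
      ≡⟨ allB-∧ (λ s → colInc (g v s) (g v (suc s))) newCellOK (iterate suc 0 R) ⟩
    allB (λ s → colInc (g v s) (g v (suc s))) (iterate suc 0 R) ∧ allB newCellOK (iterate suc 0 R)
      ≡⟨ cong₂ _∧_ (trans (sym (colsInc-map (g v) 0 R)) (go rv v<R)) (newCell-addable R v x x<R) ⟩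
    latticeFrom ∅ v ∧ addable (content v) x
      ≡⟨ latticeFrom-∷ʳ ∅ v x ⟨
    latticeFrom ∅ (v ∷ʳ x) ∎
    where
    open ≡-Reasoning
    N = 1 + length v
    newCellOK : ℕ → Bool
    newCellOK s = if x ≡ᵇ suc s then length (g v (suc s)) <ᵇ length (g v s) else true
    v<R = proj₁ (∷ʳ⁻ v∷x<R)
    x<R = proj₂ (∷ʳ⁻ v∷x<R)

-- Standard Young tableaux are lattice words

allB⇒All : ∀ {A : Set} (p : A → Bool) xs → T (allB p xs) → All (T ∘ p) xs
allB⇒All p []       _   = []
allB⇒All p (x ∷ xs) all with px , pxs ← T-∧⁻ {p x} all = px ∷ allB⇒All p xs pxs

All⇒allB : ∀ {A : Set} (p : A → Bool) {xs} → All (T ∘ p) xs → T (allB p xs)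
All⇒allB p []         = _
All⇒allB p (px ∷ pxs) = T-∧⁺ px (All⇒allB p pxs)

isSYT⁻ : ∀ λ′ t → T (isSYT λ′ t) →
  T (hasShape λ′ t) × T (allB (λ i → occ i (concat t) ≡ᵇ 1) (oneTo (size λ′)))
  × T (allB strictInc t) × T (colsInc t)
isSYT⁻ λ′ t syt
  with shape , rest ← T-∧⁻ {hasShape λ′ t} syt
  with entries , rest′ ← T-∧⁻ {allB (λ i → occ i (concat t) ≡ᵇ 1) (oneTo (size λ′))} rest
  = shape , entries , T-∧⁻ {allB strictInc t} rest′

hasShape⇒ : ∀ λ′ t → T (hasShape λ′ t) → map length t ≡ λ′
hasShape⇒ []       []      _     = refl
hasShape⇒ (m ∷ λ′) (r ∷ t) shape with r≡m , rest ← T-∧⁻ {length r ≡ᵇ m} shape =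
  cong₂ _∷_ (≡ᵇ⇒≡ (length r) m r≡m) (hasShape⇒ λ′ t rest)

hasShape⇐ : ∀ λ′ t → map length t ≡ λ′ → T (hasShape λ′ t)
hasShape⇐ []       []      _    = _
hasShape⇐ (m ∷ λ′) (r ∷ t) refl = T-∧⁺ (≡⇒≡ᵇ (length r) (length r) refl) (hasShape⇐ λ′ t refl)

length-concat : ∀ {A : Set} (xss : List (List A)) → length (concat xss) ≡ sum (map length xss)
length-concat []         = refl
length-concat (xs ∷ xss) = trans (length-++ xs) (cong (length xs +_) (length-concat xss))

occ-lookup-≤ : ∀ i (t : Filling) s → occ i (lookup t s) ≤ occ i (concat t)
occ-lookup-≤ i (r ∷ t) Fin.zero    = subst (occ i r ≤_) (sym (occ-++ i r (concat t))) (m≤m+n (occ i r) _)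
occ-lookup-≤ i (r ∷ t) (Fin.suc s) =
  subst (occ i (lookup t s) ≤_) (sym (occ-++ i r (concat t))) (m≤n⇒m≤o+n (occ i r) (occ-lookup-≤ i t s))

∈ᵇ-lookup : ∀ i (t : Filling) → occ i (concat t) ≡ 1 →
            ∀ s → i ∈ᵇ lookup t s ≡ (rowOf i t ≡ᵇ toℕ s)
∈ᵇ-lookup i (r ∷ t) once s with i ∈ᵇ r in i∈r | s
... | true  | Fin.zero   = i∈r
... | true  | Fin.suc s′ = trans (∈ᵇ-occ i (lookup t s′))
  (cong (0 <ᵇ_) (n≤0⇒n≡0 (subst (occ i (lookup t s′) ≤_) rest≡0 (occ-lookup-≤ i t s′))))
  where
  rest≡0 : occ i (concat t) ≡ 0
  rest≡0 with occ i r | ∈ᵇ⇒occ>0 i r i∈r | trans (sym (occ-++ i r (concat t))) once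
  ... | suc m | _ | 1+m+rest≡1 = m+n≡0⇒n≡0 m (suc-injective 1+m+rest≡1)
... | false | Fin.zero   = i∈r
... | false | Fin.suc s′ = ∈ᵇ-lookup i t (trans (sym (cong (_+ occ i (concat t)) (∉ᵇ⇒occ≡0 i r i∈r)))
                                           (trans (sym (occ-++ i r (concat t))) once)) s′

rowOf<length : ∀ i (t : Filling) → 0 < occ i (concat t) → rowOf i t < length t
rowOf<length i (r ∷ t) occurs with i ∈ᵇ r in i∈r
... | true  = z<s
... | false = s≤s (rowOf<length i t (subst (0 <_) (trans (occ-++ i r (concat t))
                    (cong (_+ occ i (concat t)) (∉ᵇ⇒occ≡0 i r i∈r))) occurs))

record LatticeWordOf (λ′ : List ℕ) (u : List ℕ) : Set where
  field
    length≡  : length u ≡ size λ′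
    lattice  : Lattice u
    content≡ : map (λ s → occ s u) (iterate suc 0 (length λ′)) ≡ λ′

  bounded : All (_< length λ′) u
  bounded = All.map proj₂ (count-complete 0 (length λ′) u (trans (cong sum content≡) (sym length≡)))

evacuation-LatticeWordOf : ∀ {λ′ u} → LatticeWordOf λ′ u → LatticeWordOf λ′ (evacuation (size λ′) u)
evacuation-LatticeWordOf {λ′} {u} w = record
  { length≡  = length-evacuation (size λ′) u
  ; lattice  = lattice-evacuation (size λ′) u length≡ lattice
  ; content≡ = trans (map-cong (evacuation-occ (size λ′) u length≡) (iterate suc 0 (length λ′))) content≡
  }
  where open LatticeWordOf w

tableau-isSYT : ∀ λ′ u → LatticeWordOf λ′ u → T (isSYT λ′ (tableau (length λ′) u))
tableau-isSYT λ′ u w = T-∧⁺ shape (T-∧⁺ entries (T-∧⁺ rows columns))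
  where
  open LatticeWordOf w
  R = length λ′
  n = size λ′
  shape : T (hasShape λ′ (tableau R u))
  shape = hasShape⇐ λ′ (tableau R u) (trans (map-length-tableau R u) content≡)
  once : ∀ i → InRange 1 n i → occ i (concat (tableau R u)) ≡ 1
  once i i∈ = begin
    occ i (concat (tableau R u))                            ≡⟨ occ-concat i (tableau R u) ⟩
    sum (map (occ i) (tableau R u))                         ≡⟨ cong sum (map-∘ (iterate suc 0 R)) ⟨
    sum (map (λ s → occ i (cells 1 s u)) (iterate suc 0 R))
      ≡⟨ sum-occ-cells 1 R u bounded i (subst (λ m → InRange 1 m i) (sym length≡) i∈) ⟩
    1                                                       ∎
    where open ≡-Reasoning
  entries : T (allB (λ i → occ i (concat (tableau R u)) ≡ᵇ 1) (oneTo n))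
  entries = subst (T ∘ allB (λ i → occ i (concat (tableau R u)) ≡ᵇ 1)) (sym (oneTo≡iterate n))
    (All⇒allB _ (All-iterate 1 n λ i i∈ → ≡⇒≡ᵇ _ 1 (once i i∈)))
  rows : T (allB strictInc (tableau R u))
  rows = All⇒allB strictInc
    (map⁺ (All.universal (λ s → positions-strictInc 1 (map (_≡ᵇ s) u)) (iterate suc 0 R)))
  columns : T (colsInc (tableau R u))
  columns = subst T (sym (colsInc-tableau R u bounded)) lattice

rowWord-tableau : ∀ λ′ u → LatticeWordOf λ′ u → rowWord (tableau (length λ′) u) (size λ′) ≡ u
rowWord-tableau λ′ u w =
  trans (cong (rowWord (tableau (length λ′) u)) (sym length≡)) (rowWord-cells 1 (length λ′) u bounded)
  where open LatticeWordOf w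

module RowWord (λ′ : List ℕ) (t : Filling) (syt : T (isSYT λ′ t)) where

  private
    n = size λ′
    R = length λ′
    syt⁻ = isSYT⁻ λ′ t syt

    shape : map length t ≡ λ′
    shape = hasShape⇒ λ′ t (proj₁ syt⁻)

    rows-increasing : All (T ∘ strictInc) t
    rows-increasing = allB⇒All strictInc t (proj₁ (proj₂ (proj₂ syt⁻)))

    length-t : length t ≡ R
    length-t = trans (sym (length-map length t)) (cong length shape)

    once : ∀ i → InRange 1 n i → occ i (concat t) ≡ 1
    once i i∈ = ≡ᵇ⇒≡ _ 1 (All-iterate⁻ 1 n
      (subst (All _) (oneTo≡iterate n) (allB⇒All _ (oneTo n) (proj₁ (proj₂ syt⁻)))) i i∈)

    -- the n cells hold each of 1, …, n once, so they hold nothing else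
    entries-in-range : All (InRange 1 n) (concat t)
    entries-in-range = count-complete 1 n (concat t)
      (trans (sum-map-iterate-1 (λ i → occ i (concat t)) 1 n once)
             (sym (trans (length-concat t) (cong sum shape))))

  w : List ℕ
  w = rowWord t n

  private
    row≡cells : ∀ s → lookup t s ≡ cells 1 (toℕ s) w
    row≡cells s = begin
      lookup t s
        ≡⟨ strictInc-positions 1 n (lookup t s)
             (All.lookup rows-increasing (∈-lookup s))
             (All.lookup (concat⁻ {xss = t} entries-in-range) (∈-lookup s)) ⟩
      positions 1 (map (_∈ᵇ lookup t s) (iterate suc 1 n))
        ≡⟨ cong (positions 1) (map-cong-local (All-iterate 1 n λ i i∈ →
             ∈ᵇ-lookup i t (once i i∈) s)) ⟩
      positions 1 (map (λ i → rowOf i t ≡ᵇ toℕ s) (iterate suc 1 n))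
        ≡⟨ cong (positions 1) (map-∘ (iterate suc 1 n)) ⟩
      cells 1 (toℕ s) w ∎
      where open ≡-Reasoning

  tableau-w : t ≡ tableau R w
  tableau-w = begin
    t                                  ≡⟨ tabulate-lookup t ⟨
    tabulate (lookup t)                ≡⟨ tabulate-cong row≡cells ⟩
    tabulate (λ s → cells 1 (toℕ s) w) ≡⟨ map-iterate≡tabulate (λ s → cells 1 s w) 0 (length t) ⟨
    tableau (length t) w               ≡⟨ cong (λ m → tableau m w) length-t ⟩
    tableau R w                        ∎
    where open ≡-Reasoning

  latticeWord : LatticeWordOf λ′ w
  latticeWord = record
    { length≡  = trans (length-map (λ i → rowOf i t) (iterate suc 1 n)) (length-iterate suc 1 n)
    ; lattice  = subst T (trans (cong colsInc tableau-w) (colsInc-tableau R w bounded))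
                         (proj₂ (proj₂ (proj₂ syt⁻)))
    ; content≡ = trans (sym (map-length-tableau R w)) (trans (cong (map length) (sym tableau-w)) shape)
    }
    where
    bounded : All (_< R) w
    bounded = map⁺ (All-iterate 1 n λ i i∈ →
      subst (rowOf i t <_) length-t (rowOf<length i t (subst (0 <_) (sym (once i i∈)) z<s)))

-- maj and dep through the ascents of the row word

indexSum : (ℕ → ℕ) → List Bool → ℕ
indexSum f []       = 0
indexSum f (b ∷ bs) = (if b then f 0 else 0) + indexSum (f ∘ suc) bs

indexSum-cong : ∀ {f g} bs → (∀ j → j < length bs → f j ≡ g j) → indexSum f bs ≡ indexSum g bs
indexSum-cong []       _   = refl
indexSum-cong (b ∷ bs) f≡g =
  cong₂ _+_ (cong (if b then_else 0) (f≡g 0 z<s)) (indexSum-cong bs λ j j< → f≡g (suc j) (s≤s j<))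

indexSum-∷ʳ : ∀ f bs b → indexSum f (bs ∷ʳ b) ≡ indexSum f bs + (if b then f (length bs) else 0)
indexSum-∷ʳ f []        b = +-identityʳ (if b then f 0 else 0)
indexSum-∷ʳ f (b′ ∷ bs) b = trans (cong ((if b′ then f 0 else 0) +_) (indexSum-∷ʳ (f ∘ suc) bs b))
  (sym (+-assoc (if b′ then f 0 else 0) (indexSum (f ∘ suc) bs) _))

indexSum-reverse : ∀ f bs → indexSum f (reverse bs) ≡ indexSum (λ j → f (length bs ∸ suc j)) bs
indexSum-reverse f []       = refl
indexSum-reverse f (b ∷ bs) = begin
  indexSum f (reverse (b ∷ bs))
    ≡⟨ cong (indexSum f) (unfold-reverse b bs) ⟩
  indexSum f (reverse bs ∷ʳ b)
    ≡⟨ indexSum-∷ʳ f (reverse bs) b ⟩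
  indexSum f (reverse bs) + (if b then f (length (reverse bs)) else 0)
    ≡⟨ cong₂ _+_ (indexSum-reverse f bs) (cong (λ m → if b then f m else 0) (length-reverse bs)) ⟩
  indexSum (λ j → f (length bs ∸ suc j)) bs + (if b then f (length bs) else 0)
    ≡⟨ +-comm _ (if b then f (length bs) else 0) ⟩
  indexSum (λ j → f (length (b ∷ bs) ∸ suc j)) (b ∷ bs) ∎
  where open ≡-Reasoning

indexSum-reverse-complement : ∀ n bs → length bs ≡ n ∸ 1 →
                              indexSum (λ j → n ∸ suc j) (reverse bs) ≡ indexSum suc bs
indexSum-reverse-complement zero    []  _   = refl
indexSum-reverse-complement (suc L) bs  len = trans (indexSum-reverse (λ j → suc L ∸ suc j) bs)
  (indexSum-cong bs λ j j< →
    trans (cong (λ m → L ∸ (m ∸ suc j)) len) (m∸[m∸n]≡n (subst (suc j ≤_) len j<)))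

sum-map-positions : ∀ (g : ℕ → ℕ) k bs → sum (map g (positions k bs)) ≡ indexSum (λ j → g (k + j)) bs
sum-map-positions g k []           = refl
sum-map-positions g k (true ∷ bs)  = cong₂ _+_ (cong g (sym (+-identityʳ k)))
  (trans (sum-map-positions g (suc k) bs) (indexSum-cong bs λ j _ → cong g (sym (+-suc k j))))
sum-map-positions g k (false ∷ bs) =
  trans (sum-map-positions g (suc k) bs) (indexSum-cong bs λ j _ → cong g (sym (+-suc k j)))

-- Σ (i - 1) αᵢ counts each descent a once for each of the n - a letters after it
weighted-compositionFrom : ∀ bs k p j n → p ≤ k → k + length bs ≤ suc n →
  weighted j (compositionFrom p (positions k bs) n) ≡ j * (n ∸ p) + sum (map (n ∸_) (positions k bs))
weighted-compositionFrom []           k p j n _   _  = refl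
weighted-compositionFrom (false ∷ bs) k p j n p≤k k+ =
  weighted-compositionFrom bs (suc k) p j n (m≤n⇒m≤1+n p≤k) (subst (_≤ suc n) (+-suc k (length bs)) k+)
weighted-compositionFrom (true ∷ bs)  k p j n p≤k k+ = begin
  j * (k ∸ p) + weighted (suc j) (compositionFrom k (positions (suc k) bs) n)
    ≡⟨ cong (j * (k ∸ p) +_) (weighted-compositionFrom bs (suc k) k (suc j) n (n≤1+n k)
                                 (subst (_≤ suc n) (+-suc k (length bs)) k+)) ⟩
  j * (k ∸ p) + (suc j * (n ∸ k) + S)
    ≡⟨ solve 4 (λ j a b S → j :* a :+ ((con 1 :+ j) :* b :+ S) := j :* (a :+ b) :+ (b :+ S))
             refl j (k ∸ p) (n ∸ k) S ⟩
  j * ((k ∸ p) + (n ∸ k)) + ((n ∸ k) + S)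
    ≡⟨ cong (λ m → j * m + ((n ∸ k) + S)) (∸-split p≤k k≤n) ⟨
  j * (n ∸ p) + ((n ∸ k) + S) ∎
  where
  open ≡-Reasoning
  S = sum (map (n ∸_) (positions (suc k) bs))
  k≤n : k ≤ n
  k≤n = ≤-pred (≤-trans (s≤s (m≤m+n k (length bs))) (subst (_≤ suc n) (+-suc k (length bs)) k+))

ascents-map-iterate : ∀ (f : ℕ → ℕ) k m →
  ascents (map f (iterate suc k m)) ≡ map (λ i → f i <ᵇ f (suc i)) (iterate suc k (m ∸ 1))
ascents-map-iterate f k zero          = refl
ascents-map-iterate f k (suc zero)    = refl
ascents-map-iterate f k (suc (suc m)) = cong ((f k <ᵇ f (suc k)) ∷_) (ascents-map-iterate f (suc k) (suc m))

module Statistics (λ′ : List ℕ) (T′ : SYT λ′) where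

  private
    t = proj₁ T′
    n = size λ′
    bs = ascents (rowWord t n)

    Des≡positions : Des λ′ T′ ≡ positions 1 bs
    Des≡positions = begin
      filter (λ i → rowOf i t <? rowOf (suc i) t) (oneTo (n ∸ 1))
        ≡⟨ cong (filter _) (oneTo≡iterate (n ∸ 1)) ⟩
      filter (λ i → rowOf i t <? rowOf (suc i) t) (iterate suc 1 (n ∸ 1))
        ≡⟨ filter-iterate (λ i → rowOf i t <? rowOf (suc i) t) 1 (n ∸ 1) ⟩
      positions 1 (map (λ i → rowOf i t <ᵇ rowOf (suc i) t) (iterate suc 1 (n ∸ 1)))
        ≡⟨ cong (positions 1) (ascents-map-iterate (λ i → rowOf i t) 1 n) ⟨
      positions 1 bs ∎
      where open ≡-Reasoning

  length-ascents-rowWord : length bs ≡ n ∸ 1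
  length-ascents-rowWord = trans (length-ascents (rowWord t n))
    (cong (_∸ 1) (trans (length-map (λ i → rowOf i t) (iterate suc 1 n)) (length-iterate suc 1 n)))

  maj≡indexSum : maj λ′ T′ ≡ indexSum suc bs
  maj≡indexSum =
    trans (cong sum (trans Des≡positions (sym (map-id (positions 1 bs))))) (sum-map-positions id 1 bs)

  dep≡indexSum : dep λ′ T′ ≡ indexSum (λ j → n ∸ suc j) bs
  dep≡indexSum = begin
    weighted 0 (compositionFrom 0 (Des λ′ T′) n)
      ≡⟨ cong (λ as → weighted 0 (compositionFrom 0 as n)) Des≡positions ⟩
    weighted 0 (compositionFrom 0 (positions 1 bs) n)
      ≡⟨ weighted-compositionFrom bs 1 0 0 n z≤n
           (s≤s (subst (_≤ n) (sym length-ascents-rowWord) (m∸n≤m n 1))) ⟩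
    sum (map (n ∸_) (positions 1 bs))
      ≡⟨ sum-map-positions (n ∸_) 1 bs ⟩
    indexSum (λ j → n ∸ suc j) bs ∎
    where open ≡-Reasoning

-- Evacuation of standard Young tableaux

involution-fibres-↔ : ∀ {A : Set} (Φ : A → A) (f g : A → ℕ) →
  (∀ a → Φ (Φ a) ≡ a) → (∀ a → g (Φ a) ≡ f a) →
  ∀ k → Σ A (λ a → f a ≡ k) ↔ Σ A (λ a → g a ≡ k)
involution-fibres-↔ {A} Φ f g Φ∘Φ g∘Φ k = mk↔ₛ′
  (λ (a , fa≡k) → Φ a , trans (g∘Φ a) fa≡k)
  (λ (a , ga≡k) → Φ a , trans (trans (sym (g∘Φ (Φ a))) (cong g (Φ∘Φ a))) ga≡k)
  (λ (a , _) → Σ-≡ (Φ∘Φ a))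
  (λ (a , _) → Σ-≡ (Φ∘Φ a))
  where
  Σ-≡ : ∀ {h : A → ℕ} {a b} {p : h a ≡ k} {q : h b ≡ k} → a ≡ b → (a , p) ≡ (b , q)
  Σ-≡ {p = p} {q} refl = cong (_ ,_) (≡-irrelevant p q)

module Evacuation (λ′ : List ℕ) where

  private
    n = size λ′
    R = length λ′

  Φ : SYT λ′ → SYT λ′
  Φ (t , syt) =
    tableau R (evacuation n w) , tableau-isSYT λ′ (evacuation n w) (evacuation-LatticeWordOf latticeWord)
    where open RowWord λ′ t syt

  rowWord-Φ : ∀ T′ → rowWord (proj₁ (Φ T′)) n ≡ evacuation n (rowWord (proj₁ T′) n)
  rowWord-Φ (t , syt) = rowWord-tableau λ′ (evacuation n w) (evacuation-LatticeWordOf latticeWord)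
    where open RowWord λ′ t syt

  Φ-involutive : ∀ T′ → Φ (Φ T′) ≡ T′
  Φ-involutive (t , syt) = SYT-≡ (begin
    tableau R (evacuation n (rowWord (proj₁ (Φ (t , syt))) n))
      ≡⟨ cong (tableau R ∘ evacuation n) (rowWord-Φ (t , syt)) ⟩
    tableau R (evacuation n (evacuation n w))
      ≡⟨ cong (tableau R) (evacuation-involutive n w length≡) ⟩
    tableau R w
      ≡⟨ tableau-w ⟨
    t ∎)
    where
    open ≡-Reasoning
    open RowWord λ′ t syt
    open LatticeWordOf latticeWord using (length≡)
    SYT-≡ : ∀ {t₁ t₂} {p₁ : T (isSYT λ′ t₁)} {p₂ : T (isSYT λ′ t₂)} →
            t₁ ≡ t₂ → (t₁ , p₁) ≡ (t₂ , p₂)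
    SYT-≡ {p₁ = p₁} {p₂} refl = cong (_ ,_) (T-irrelevant p₁ p₂)

  dep-Φ : ∀ T′ → dep λ′ (Φ T′) ≡ maj λ′ T′
  dep-Φ (t , syt) = begin
    dep λ′ (Φ (t , syt))
      ≡⟨ Statistics.dep≡indexSum λ′ (Φ (t , syt)) ⟩
    indexSum (λ j → n ∸ suc j) (ascents (rowWord (proj₁ (Φ (t , syt))) n))
      ≡⟨ cong (indexSum (λ j → n ∸ suc j) ∘ ascents) (rowWord-Φ (t , syt)) ⟩
    indexSum (λ j → n ∸ suc j) (ascents (evacuation n w))
      ≡⟨ cong (indexSum (λ j → n ∸ suc j)) (ascents-evacuation n w length≡ lattice) ⟩
    indexSum (λ j → n ∸ suc j) (reverse (ascents w))
      ≡⟨ indexSum-reverse-complement n (ascents w) (Statistics.length-ascents-rowWord λ′ (t , syt)) ⟩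
    indexSum suc (ascents w)
      ≡⟨ Statistics.maj≡indexSum λ′ (t , syt) ⟨
    maj λ′ (t , syt) ∎
    where
    open ≡-Reasoning
    open RowWord λ′ t syt
    open LatticeWordOf latticeWord using (length≡; lattice)

mainTheorem19 : (λ′ : List ℕ) → IsPartition λ′ → (k : ℕ)
                → Σ (SYT λ′) (λ T → maj λ′ T ≡ k) ↔ Σ (SYT λ′) (λ T → dep λ′ T ≡ k)
mainTheorem19 λ′ _ = involution-fibres-↔ Φ (maj λ′) (dep λ′) Φ-involutive dep-Φ
  where open Evacuation λ′
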